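{- Let $n,m\ge1$, $p\ge2$ be integers. If an $n\times m$ matrix $A$ with entries in $[p]=\{0,1,\ldots,p-1\}$ is canonical, then $A$ is semi-canonical.
   Context: For $A=(a_{ij})$ an $n\times m$ matrix with entries in $[p]$, put $x_i=\sum_{j=1}^m a_{ij}p^{m-j}$ and $y_j=\sum_{i=1}^n a_{ij}p^{n-i}$, and $r(A)=\langle x_1,\ldots,x_n\rangle$, $c(A)=\langle y_1,\ldots,y_m\rangle$. Two such matrices $A,B$ are equivalent, $A\sim B$, if $A=XBY$ for some $n\times n$ permutation matrix $X$ and $m\times m$ permutation matrix $Y$ (i.e. $A$ is obtained from $B$ by permuting rows and columns). $A$ is canonical if $r(A)$ is the minimal element, in the lexicographic order, of $\{r(B): B\sim A\}$. $A$ is semi-canonical if $x_1\le\cdots\le x_n$ and $y_1\le\cdots\le y_m$. -}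

module Defs where

open import Data.Nat using (ℕ; zero; suc; _+_; _*_; _^_; _≤_; _<_)
open import Data.Fin using (Fin; toℕ)
open import Data.List using (List; []; _∷_; sum; map)
open import Data.List using (allFin)
open import Data.Product using (Σ; _×_; _,_)
open import Data.Sum using (_⊎_)
open import Data.Unit using (⊤)
open import Data.Empty using (⊥)
open import Function.Bundles using (_↔_; Inverse)
open import Relation.Binary.PropositionalEquality using (_≡_)

Matrix : ℕ → ℕ → ℕ → Set
Matrix n m p = Fin n → Fin m → Fin p

digitsValue : ℕ → List ℕ → ℕ
digitsValue p ds = go 0 ds
  where
  go : ℕ → List ℕ → ℕ
  go acc []       = acc
  go acc (d ∷ ds) = go (acc * p + d) ds

-- x_i = Σ_j a_ij p^(m-j)   (1-based j)
rowVal : ∀ {n m p} → Matrix n m p → Fin n → ℕ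
rowVal {n} {m} {p} A i = digitsValue p (map (λ j → toℕ (A i j)) (allFin m))

-- y_j = Σ_i a_ij p^(n-i)
colVal : ∀ {n m p} → Matrix n m p → Fin m → ℕ
colVal {n} {m} {p} A j = digitsValue p (map (λ i → toℕ (A i j)) (allFin n))

r : ∀ {n m p} → Matrix n m p → List ℕ
r {n} A = map (rowVal A) (allFin n)

c : ∀ {n m p} → Matrix n m p → List ℕ
c {n} {m} A = map (colVal A) (allFin m)

_≤lex_ : List ℕ → List ℕ → Set
[]       ≤lex _        = ⊤
(x ∷ xs) ≤lex []       = ⊥
(x ∷ xs) ≤lex (y ∷ ys) = (x < y) ⊎ ((x ≡ y) × (xs ≤lex ys))

-- A ∼ B : A is obtained from B by permuting rows and columns,
-- i.e. A = X B Y with X, Y permutation matrices.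
_∼_ : ∀ {n m p} → Matrix n m p → Matrix n m p → Set
_∼_ {n} {m} A B =
  Σ (Fin n ↔ Fin n) λ σ → Σ (Fin m ↔ Fin m) λ τ →
    ∀ i j → A i j ≡ B (Inverse.to σ i) (Inverse.to τ j)

Canonical : ∀ {n m p} → Matrix n m p → Set
Canonical {n} {m} {p} A = ∀ (B : Matrix n m p) → B ∼ A → r A ≤lex r B

data Sorted : List ℕ → Set where
  []  : Sorted []
  [_] : ∀ x → Sorted (x ∷ [])
  _∷_ : ∀ {x y ys} → x ≤ y → Sorted (y ∷ ys) → Sorted (x ∷ y ∷ ys)

SemiCanonical : ∀ {n m p} → Matrix n m p → Set
SemiCanonical A = Sorted (r A) × Sorted (c A)

-- If x_k' < x_k for some k < k', swapping rows k and k' makes r(A) lexicographically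
-- smaller. If y_k' < y_k, then, since base-p numerals compare like their digit strings,
-- the topmost row i₀ in which columns k and k' differ has a_i₀k' < a_i₀k; swapping the
-- two columns leaves the rows above i₀ unchanged and decreases x_i₀, again lowering r(A).

module Submission where

open import Defs
open import Data.Nat using (ℕ; _≤_; zero; suc; _+_; _*_; _<_; z≤n; s≤s)
open import Data.Nat.Properties
open import Data.Fin as F using (Fin; toℕ)
open import Data.Fin.Properties using (toℕ<n) renaming (_≟_ to _≟ᶠ_)
import Data.Fin.Permutation as Perm
open import Data.Fin.Permutation.Components using (transpose)
open import Data.List using (_∷_; map; tabulate; allFin)
open import Data.List.Properties using (map-tabulate; map-cong)
open import Data.Product using (∃; _×_; _,_)
open import Data.Sum using (_⊎_; inj₁; inj₂)
open import Data.Empty using (⊥-elim)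
open import Function using (_∘_)
open import Relation.Nullary using (¬_; yes; no)
open import Relation.Nullary.Decidable using (dec-true; dec-false)
open import Relation.Binary using (tri<; tri≈; tri>)
open import Relation.Binary.PropositionalEquality

private
  variable
    n m p : ℕ

map-allFin : (f : Fin n → ℕ) → map f (allFin n) ≡ tabulate f
map-allFin f = map-tabulate (λ i → i) f


infix 4 _≺[_]_

_≺[_]_ : (Fin n → ℕ) → Fin n → (Fin n → ℕ) → Set
g ≺[ k ] f = (∀ i → i F.< k → g i ≡ f i) × g k < f k

≺-tail : {f g : Fin (suc n) → ℕ} {k : Fin n} → g ≺[ F.suc k ] f → g ∘ F.suc ≺[ k ] f ∘ F.suc
≺-tail (agree , less) = (λ i i<k → agree (F.suc i) (s≤s i<k)) , less

≺-cmp : (f g : Fin n → ℕ) → (∀ i → g i ≡ f i) ⊎ (∃ (g ≺[_] f) ⊎ ∃ (f ≺[_] g))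
≺-cmp {zero}  f g = inj₁ λ ()
≺-cmp {suc n} f g with <-cmp (g F.zero) (f F.zero)
... | tri< g₀<f₀ _ _ = inj₂ (inj₁ (F.zero , (λ _ ()) , g₀<f₀))
... | tri> _ _ f₀<g₀ = inj₂ (inj₂ (F.zero , (λ _ ()) , f₀<g₀))
... | tri≈ _ g₀≡f₀ _ with ≺-cmp (f ∘ F.suc) (g ∘ F.suc)
...   | inj₁ eq = inj₁ λ { F.zero → g₀≡f₀ ; (F.suc i) → eq i }
...   | inj₂ (inj₁ (k , agree , less)) =
          inj₂ (inj₁ (F.suc k , (λ { F.zero _ → g₀≡f₀ ; (F.suc i) (s≤s i<k) → agree i i<k }) , less))
...   | inj₂ (inj₂ (k , agree , less)) =
          inj₂ (inj₂ (F.suc k , (λ { F.zero _ → sym g₀≡f₀ ; (F.suc i) (s≤s i<k) → agree i i<k }) , less))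

≺⇒¬tabulate-≤lex : {f g : Fin n → ℕ} (k : Fin n) → g ≺[ k ] f → ¬ (tabulate f ≤lex tabulate g)
≺⇒¬tabulate-≤lex F.zero    (_ , g₀<f₀)     (inj₁ f₀<g₀)     = <-asym g₀<f₀ f₀<g₀
≺⇒¬tabulate-≤lex F.zero    (_ , g₀<f₀)     (inj₂ (f₀≡g₀ , _)) = <-irrefl (sym f₀≡g₀) g₀<f₀
≺⇒¬tabulate-≤lex (F.suc k) (agree , _)     (inj₁ f₀<g₀)     = <-irrefl (sym (agree F.zero (s≤s z≤n))) f₀<g₀
≺⇒¬tabulate-≤lex (F.suc k) g≺f             (inj₂ (_ , tail)) = ≺⇒¬tabulate-≤lex k (≺-tail g≺f) tail

≺⇒¬≤lex : {f g : Fin n → ℕ} (k : Fin n) → g ≺[ k ] f → ¬ (map f (allFin n) ≤lex map g (allFin n))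
≺⇒¬≤lex {f = f} {g} k g≺f rewrite map-allFin f | map-allFin g = ≺⇒¬tabulate-≤lex k g≺f


fromDigits : ℕ → (Fin n → ℕ) → ℕ
fromDigits {n} p f = digitsValue p (map f (allFin n))

fromDigits-cong : {f g : Fin n → ℕ} → (∀ i → g i ≡ f i) → fromDigits p g ≡ fromDigits p f
fromDigits-cong {n} {p = p} g≗f = cong (digitsValue p) (map-cong g≗f (allFin n))

module _ {p : ℕ} where

  private
    horner-< : ∀ {a b d e} → a < b → d < p → a * p + d < b * p + e
    horner-< {a} {b} {d} {e} a<b d<p = begin-strict
      a * p + d  <⟨ +-monoʳ-< (a * p) d<p ⟩
      a * p + p  ≡⟨ +-comm (a * p) p ⟩
      suc a * p  ≤⟨ *-monoˡ-≤ p a<b ⟩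
      b * p      ≤⟨ m≤m+n (b * p) e ⟩
      b * p + e  ∎
      where open ≤-Reasoning

  -- digitsValue p (a ∷ ds) unfolds to Horner evaluation of ds from accumulator a,
  -- so the leading digits serve as the induction's accumulator.
  digitsValue-head-< : ∀ {a b} (f g : Fin n → ℕ) → a < b → (∀ i → g i < p) →
                       digitsValue p (a ∷ tabulate g) < digitsValue p (b ∷ tabulate f)
  digitsValue-head-< {zero}  f g a<b _     = a<b
  digitsValue-head-< {suc n} f g a<b g<p =
    digitsValue-head-< (f ∘ F.suc) (g ∘ F.suc) (horner-< a<b (g<p F.zero)) (g<p ∘ F.suc)

  digitsValue-≺ : ∀ {a b} (f g : Fin n → ℕ) (k : Fin n) → a ≤ b → (∀ i → g i < p) → g ≺[ k ] f →
                  digitsValue p (a ∷ tabulate g) < digitsValue p (b ∷ tabulate f)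
  digitsValue-≺ f g F.zero a≤b g<p (_ , g₀<f₀) =
    digitsValue-head-< (f ∘ F.suc) (g ∘ F.suc) (+-mono-≤-< (*-monoˡ-≤ p a≤b) g₀<f₀) (g<p ∘ F.suc)
  digitsValue-≺ f g (F.suc k) a≤b g<p g≺f@(agree , _) =
    digitsValue-≺ (f ∘ F.suc) (g ∘ F.suc) k
      (+-mono-≤ (*-monoˡ-≤ p a≤b) (≤-reflexive (agree F.zero (s≤s z≤n)))) (g<p ∘ F.suc) (≺-tail g≺f)

  fromDigits-mono-≺ : {f g : Fin n → ℕ} (k : Fin n) → (∀ i → g i < p) → g ≺[ k ] f →
                      fromDigits p g < fromDigits p f
  fromDigits-mono-≺ {f = f} {g} k g<p g≺f rewrite map-allFin f | map-allFin g =
    digitsValue-≺ f g k z≤n g<p g≺f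

  fromDigits-<⇒≺ : {f g : Fin n → ℕ} → (∀ i → f i < p) → fromDigits p g < fromDigits p f → ∃ (g ≺[_] f)
  fromDigits-<⇒≺ {f = f} {g} f<p g<f with ≺-cmp f g
  ... | inj₁ g≗f               = ⊥-elim (<-irrefl (fromDigits-cong g≗f) g<f)
  ... | inj₂ (inj₁ g≺f)         = g≺f
  ... | inj₂ (inj₂ (k , f≺g))   = ⊥-elim (<-asym g<f (fromDigits-mono-≺ k f<p f≺g))


noInversion⇒tabulate-sorted : (f : Fin n → ℕ) → (∀ {k k'} → k F.< k' → ¬ f k' < f k) → Sorted (tabulate f)
noInversion⇒tabulate-sorted {zero}        f _     = []
noInversion⇒tabulate-sorted {suc zero}    f _     = [ f F.zero ]
noInversion⇒tabulate-sorted {suc (suc n)} f noInv =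
  ≮⇒≥ (noInv {F.zero} {F.suc F.zero} (s≤s z≤n))
    ∷ noInversion⇒tabulate-sorted (f ∘ F.suc) (λ k<k' → noInv (s≤s k<k'))

noInversion⇒sorted : (f : Fin n → ℕ) → (∀ {k k'} → k F.< k' → ¬ f k' < f k) → Sorted (map f (allFin n))
noInversion⇒sorted f noInv rewrite map-allFin f = noInversion⇒tabulate-sorted f noInv


transpose-matchˡ : (i j : Fin n) → transpose i j i ≡ j
transpose-matchˡ i j rewrite dec-true (i ≟ᶠ i) refl = refl

transpose-fix : {i j k : Fin n} → k ≢ i → k ≢ j → transpose i j k ≡ k
transpose-fix {i = i} {j} {k} k≢i k≢j rewrite dec-false (k ≟ᶠ i) k≢i | dec-false (k ≟ᶠ j) k≢j = refl

transpose-preserves : {A : Set} (h : Fin n → A) (i j k : Fin n) → h i ≡ h j → h (transpose i j k) ≡ h k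
transpose-preserves h i j k hi≡hj with k ≟ᶠ i
... | yes refl = sym hi≡hj
... | no _ with k ≟ᶠ j
...   | yes refl = hi≡hj
...   | no _     = refl

transpose-≺ : (f : Fin n → ℕ) {k k' : Fin n} → k F.< k' → f k' < f k → f ∘ transpose k k' ≺[ k ] f
transpose-≺ f {k} {k'} k<k' fk'<fk = agree , subst (λ l → f l < f k) (sym (transpose-matchˡ k k')) fk'<fk
  where
  agree : ∀ i → i F.< k → f (transpose k k' i) ≡ f i
  agree i i<k = cong f (transpose-fix (λ { refl → <-irrefl refl i<k })
                                      (λ { refl → <-irrefl refl (<-trans i<k k<k') }))


swapRows : Matrix n m p → Fin n → Fin n → Matrix n m p
swapRows A k k' i j = A (transpose k k' i) j

swapCols : Matrix n m p → Fin m → Fin m → Matrix n m p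
swapCols A k k' i j = A i (transpose k k' j)

swapRows-∼ : (A : Matrix n m p) (k k' : Fin n) → swapRows A k k' ∼ A
swapRows-∼ A k k' = Perm.transpose k k' , Perm.id , λ _ _ → refl

swapCols-∼ : (A : Matrix n m p) (k k' : Fin m) → swapCols A k k' ∼ A
swapCols-∼ A k k' = Perm.id , Perm.transpose k k' , λ _ _ → refl

swapRows-≺ : (A : Matrix n m p) {k k' : Fin n} → k F.< k' → rowVal A k' < rowVal A k →
             rowVal (swapRows A k k') ≺[ k ] rowVal A
swapRows-≺ A = transpose-≺ (rowVal A)

swapCols-≺ : (A : Matrix n m p) {k k' : Fin m} → k F.< k' → colVal A k' < colVal A k →
             ∃ λ i₀ → rowVal (swapCols A k k') ≺[ i₀ ] rowVal A
swapCols-≺ A {k} {k'} k<k' yk'<yk with fromDigits-<⇒≺ (λ i → toℕ<n (A i k)) yk'<yk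
... | i₀ , above , less = i₀ , unchanged , fromDigits-mono-≺ k (λ j → toℕ<n (A i₀ (transpose k k' j)))
                                                           (transpose-≺ (toℕ ∘ A i₀) k<k' less)
  where
  unchanged : ∀ i → i F.< i₀ → rowVal (swapCols A k k') i ≡ rowVal A i
  unchanged i i<i₀ = fromDigits-cong (λ j → transpose-preserves (toℕ ∘ A i) k k' j (sym (above i i<i₀)))


Canonical⇒¬≺ : {A B : Matrix n m p} → Canonical A → B ∼ A → (k : Fin n) → ¬ (rowVal B ≺[ k ] rowVal A)
Canonical⇒¬≺ {B = B} can B∼A k B≺A = ≺⇒¬≤lex k B≺A (can B B∼A)

Canonical⇒rows-sorted : {A : Matrix n m p} → Canonical A → Sorted (r A)
Canonical⇒rows-sorted {A = A} can = noInversion⇒sorted (rowVal A) λ {k} {k'} k<k' xk'<xk →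
  Canonical⇒¬≺ can (swapRows-∼ A k k') k (swapRows-≺ A k<k' xk'<xk)

Canonical⇒cols-sorted : {A : Matrix n m p} → Canonical A → Sorted (c A)
Canonical⇒cols-sorted {A = A} can = noInversion⇒sorted (colVal A) λ {k} {k'} k<k' yk'<yk →
  let i₀ , B≺A = swapCols-≺ A k<k' yk'<yk in
  Canonical⇒¬≺ can (swapCols-∼ A k k') i₀ B≺A

lemma2 : (n m p : ℕ) → 1 ≤ n → 1 ≤ m → 2 ≤ p →
    (A : Matrix n m p) → Canonical A → SemiCanonical A
lemma2 _ _ _ _ _ _ A can = Canonical⇒rows-sorted can , Canonical⇒cols-sorted can
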